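{- For every hypergraph $H$ with $n$ vertices, $\mathrm{ch}_{\mathrm{cf}}(H)\le\chi_{\mathrm{cf}}(H)\cdot\ln n+1$.
   Context: A coloring $C\colon V\to\mathbb{Z}_{>0}$ of $H=(V,\mathcal{E})$ is conflict-free if every hyperedge contains a vertex whose color appears exactly once in it. $\chi_{\mathrm{cf}}(H)$ is the minimum number of colors of a conflict-free coloring of $H$; $\mathrm{ch}_{\mathrm{cf}}(H)$ is the minimum $k$ such that for every family $\{L_v\}_{v\in V}$ of sets of positive integers with $|L_v|\ge k$ there is a conflict-free coloring $C$ with $C(v)\in L_v$ for all $v$. -}

module Defs where

open import Level using (0ℓ)
open import Data.Nat using (ℕ; zero; suc; _≤_)
open import Data.Integer using (+_)
open import Data.Rational using (ℚ; _/_; 0ℚ; 1ℚ; _+_; _*_)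
import Data.Rational as ℚ
open import Data.Fin using (Fin)
open import Data.Fin.Subset using (Subset; _∈_)
open import Data.List using (List)
import Data.List.Membership.Propositional as LM
open import Data.Product using (Σ; _×_; ∃)
open import Function.Definitions using (Injective)
open import Relation.Binary.PropositionalEquality using (_≡_)

record Hypergraph (n : ℕ) : Set where
  field
    edges : List (Subset n)
open Hypergraph public

-- A coloring is a function to the positive integers (positivity imposed where used).
Coloring : ℕ → Set
Coloring n = Fin n → ℕ

ConflictFree : ∀ {n} → Hypergraph n → Coloring n → Set
ConflictFree {n} H C =
  ∀ E → E LM.∈ edges H →
    Σ (Fin n) λ v → v ∈ E × (∀ u → u ∈ E → C u ≡ C v → u ≡ v)

CFColorableWith : ∀ {n} → Hypergraph n → ℕ → Set
CFColorableWith {n} H c =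
  Σ (Coloring n) λ C → (∀ v → 1 ≤ C v × C v ≤ c) × ConflictFree H C

IsChiCF : ∀ {n} → Hypergraph n → ℕ → Set
IsChiCF H c = CFColorableWith H c × (∀ c′ → CFColorableWith H c′ → c ≤ c′)

AtLeast : ℕ → (ℕ → Set) → Set
AtLeast k L = Σ (Fin k → ℕ) λ f → Injective _≡_ _≡_ f × (∀ i → L (f i))

CFChoosable : ∀ {n} → Hypergraph n → ℕ → Set₁
CFChoosable {n} H k =
  (L : Fin n → ℕ → Set) →
  (∀ v x → L v x → 1 ≤ x) →
  (∀ v → AtLeast k (L v)) →
  Σ (Coloring n) λ C → (∀ v → L v (C v)) × ConflictFree H C

IsChCF : ∀ {n} → Hypergraph n → ℕ → Set₁
IsChCF H k = CFChoosable H k × (∀ k′ → CFChoosable H k′ → k ≤ k′)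

expTerm : ℚ → ℕ → ℚ
expTerm x zero    = 1ℚ
expTerm x (suc i) = expTerm x i * x * (+ 1 / suc i)

expPartial : ℚ → ℕ → ℚ
expPartial x zero    = 0ℚ
expPartial x (suc N) = expPartial x N + expTerm x N

-- BoundHolds k c n  encodes the real inequality  k ≤ c · ln n + 1  (for n ≥ 1).
-- * c = 0 : the inequality reads k ≤ 1.
-- * c ≥ 1 : k ≤ c ln n + 1  ⇔  (k-1)/c ≤ ln n  ⇔  exp((k-1)/c) ≤ n.
--   For k = 0 both sides hold trivially, and we may replace k-1 by the truncated
--   k ∸ 1 ≥ 0.  For q ≥ 0, exp q is the supremum of the (increasing) partial sums
--   Σ_{i<N} q^i/i!, so exp q ≤ n  ⇔  every partial sum is ≤ n.
BoundHolds : ℕ → ℕ → ℕ → Set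
BoundHolds k zero    n = k ≤ 1
BoundHolds k (suc c) n =
  ∀ N → expPartial (+ (k Data.Nat.∸ 1) / suc c) N ℚ.≤ (+ n / 1)

module Submission where

-- Let c = d + 1 be the conflict-free chromatic number and fix an optimal colouring C₀. Given
-- lists of size m, give every colour x a class σ x ∈ {1, …, c} and colour each vertex v by a
-- colour of its list whose class is C₀ v: two vertices sharing a new colour share their C₀-colour,
-- so the new colouring is again conflict-free. For uniformly random σ a vertex fails with
-- probability (d/c)^m, so some σ works as soon as n·d^m < c^m; it is found by the method of
-- conditional expectations, fixing σ one colour at a time. Finally e^(m/c) ≤ (c/d)^m, since
-- (m/c)^i/i! ≤ multichoose(m,i)·c^-i termwise and Σ_i multichoose(m,i)·c^-i = (1 - 1/c)^-m; so
-- if a partial sum of e^(m/c) exceeded n, lists of size m would suffice, contradicting the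
-- minimality of k = m + 1.

open import Defs
open import Data.Nat as ℕ using (ℕ; zero; suc; _+_; _*_; _∸_; _^_; _≤_; _<_; z≤n; s≤s)
open import Data.Nat.Properties
open import Data.Nat.Tactic.RingSolver using (solve-∀)
import Data.Nat.Coprimality as Coprime
open import Data.Integer as ℤ using (+_)
import Data.Integer.Properties as ℤₚ
open import Data.Rational as ℚ using (ℚ; _/_; mkℚ; toℚᵘ)
import Data.Rational.Properties as ℚₚ
open import Data.Rational.Unnormalised as ℚᵘ using (mkℚᵘ; *≡*)
import Data.Rational.Unnormalised.Properties as ℚᵘₚ
open import Data.Rational.Solver using (module +-*-Solver)
open import Algebra.Properties.Semiring.Sum +-*-semiring
  using (sum; sum-syntax; sum-cong-≗; sum-remove; ∑-comm; *-distribˡ-sum)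
open import Data.Fin as Fin using (Fin; zero; suc; punchIn; fromℕ<; toℕ)
open import Data.Fin.Properties using (punchInᵢ≢i; toℕ-fromℕ<)
open import Data.Maybe using (Maybe; just; nothing)
open import Data.Product using (Σ; ∃; _×_; _,_; proj₁; proj₂)
open import Data.Unit using (⊤; tt)
open import Data.Empty using (⊥; ⊥-elim)
open import Data.List using (List; []; _∷_; length; filter; tabulate; concat)
open import Data.List.Properties using (filter-accept; filter-reject; filter-all; length-tabulate)
import Data.List.Relation.Unary.All as All
open import Data.List.Relation.Unary.Any using (Any; here; there)
import Data.List.Relation.Unary.Any.Properties as Any
open import Data.List.Relation.Unary.Unique.Propositional using (Unique; _∷_)
import Data.List.Relation.Unary.Unique.Propositional.Properties as Unique
open import Data.List.Relation.Binary.Subset.Propositional using (_⊆_)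
open import Data.List.Membership.Propositional using (_∈_; _∉_; find; lose)
open import Data.List.Membership.Propositional.Properties using (∈-filter⁻; ∈-tabulate⁺; ∈-concat⁺′)
open import Data.List.Membership.DecPropositional _≟_ using (_∈?_)
open import Function using (_∘_)
open import Function.Definitions using (Injective)
open import Relation.Nullary using (¬_; Dec; yes; no; ¬?)
open import Relation.Binary.PropositionalEquality

-- The exponential series against (1 - 1/c)^-m

multichoose : ℕ → ℕ → ℕ
multichoose m       zero    = 1
multichoose zero    (suc i) = 0
multichoose (suc m) (suc i) = multichoose m (suc i) + multichoose (suc m) i

multichoose-suc : ∀ m i → (m + i) * multichoose m i ≡ suc i * multichoose m (suc i)
multichoose-suc zero    zero    = refl
multichoose-suc zero    (suc i) = trans (*-zeroʳ (suc i)) (sym (*-zeroʳ (suc (suc i))))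
multichoose-suc (suc m) zero    = begin
  (suc m + 0) * 1              ≡⟨ cong suc (multichoose-suc m 0) ⟩
  suc (1 * multichoose m 1)    ≡⟨ regroup (multichoose m 1) ⟩
  1 * multichoose (suc m) 1    ∎
  where
  open ≡-Reasoning
  regroup : ∀ a → suc (1 * a) ≡ 1 * (a + 1)
  regroup = solve-∀
multichoose-suc (suc m) (suc i) = begin
  (suc m + suc i) * (A + B)                      ≡⟨ expand m i A B ⟩
  (m + suc i) * A + (suc m + i) * B + (A + B)    ≡⟨ cong₂ (λ x y → x + y + (A + B)) IH₁ IH₂ ⟩
  suc (suc i) * C + suc i * (A + B) + (A + B)    ≡⟨ collect i C (A + B) ⟩
  suc (suc i) * (C + (A + B))                    ∎
  where
  open ≡-Reasoning
  A = multichoose m (suc i)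
  B = multichoose (suc m) i
  C = multichoose m (suc (suc i))
  IH₁ = multichoose-suc m (suc i)
  IH₂ = multichoose-suc (suc m) i
  expand : ∀ m i a b → (suc m + suc i) * (a + b) ≡ (m + suc i) * a + (suc m + i) * b + (a + b)
  expand = solve-∀
  collect : ∀ i c s → suc (suc i) * c + suc i * s + s ≡ suc (suc i) * (c + s)
  collect = solve-∀

multichoose-ratio : ∀ m i → m * multichoose m i ≤ suc i * multichoose m (suc i)
multichoose-ratio m i =
  ≤-trans (*-monoˡ-≤ (multichoose m i) (m≤m+n m i)) (≤-reflexive (multichoose-suc m i))

-- negBinomialSum c m N = Σ_{i<N} c^(N-i) · multichoose m i: c^N times the N-th partial sum
-- of Σ_i multichoose m i · c^-i, the expansion of (1 - 1/c)^-m.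
negBinomialSum : ℕ → ℕ → ℕ → ℕ
negBinomialSum c m zero    = 0
negBinomialSum c m (suc N) = c * (negBinomialSum c m N + multichoose m N)

negBinomialSum-0-≤ : ∀ c N → negBinomialSum c 0 N ≤ c ^ N
negBinomialSum-0-≤ c zero          = z≤n
negBinomialSum-0-≤ c (suc zero)    = ≤-refl
negBinomialSum-0-≤ c (suc (suc N)) =
  *-monoʳ-≤ c (≤-trans (≤-reflexive (+-identityʳ _)) (negBinomialSum-0-≤ c (suc N)))

negBinomialSum-pascal : ∀ c m N →
  negBinomialSum c (suc m) (suc N) ≡ negBinomialSum c m (suc N) + negBinomialSum c (suc m) N
negBinomialSum-pascal c m zero    = sym (+-identityʳ _)
negBinomialSum-pascal c m (suc N) = begin
  c * (V′ + (a + b))               ≡⟨ cong (λ v → c * (v + (a + b))) (negBinomialSum-pascal c m N) ⟩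
  c * (V + W + (a + b))            ≡⟨ distribute c V W a b ⟩
  c * (V + a) + c * (W + b)        ∎
  where
  open ≡-Reasoning
  V′ = negBinomialSum c (suc m) (suc N)
  V  = negBinomialSum c m (suc N)
  W  = negBinomialSum c (suc m) N
  a  = multichoose m (suc N)
  b  = multichoose (suc m) N
  distribute : ∀ c v w a b → c * (v + w + (a + b)) ≡ c * (v + a) + c * (w + b)
  distribute = solve-∀

negBinomialSum-≤-suc : ∀ c m N → c * negBinomialSum c m N ≤ negBinomialSum c m (suc N)
negBinomialSum-≤-suc c m N = *-monoʳ-≤ c (m≤m+n _ _)

negBinomialSum-shift : ∀ d m N →
  d * negBinomialSum (suc d) (suc m) (suc N) ≤ suc d * negBinomialSum (suc d) m (suc N)
negBinomialSum-shift d m N = +-cancelʳ-≤ X (d * X) (suc d * V) (begin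
  d * X + X                 ≡⟨ +-comm (d * X) X ⟩
  suc d * X                 ≡⟨ cong (suc d *_) (negBinomialSum-pascal (suc d) m N) ⟩
  suc d * (V + W)           ≡⟨ *-distribˡ-+ (suc d) V W ⟩
  suc d * V + suc d * W     ≤⟨ +-monoʳ-≤ (suc d * V) (negBinomialSum-≤-suc (suc d) (suc m) N) ⟩
  suc d * V + X             ∎)
  where
  open ≤-Reasoning
  X = negBinomialSum (suc d) (suc m) (suc N)
  V = negBinomialSum (suc d) m (suc N)
  W = negBinomialSum (suc d) (suc m) N

negBinomialSum-bound : ∀ d m N → negBinomialSum (suc d) m N * d ^ m ≤ suc d ^ (N + m)
negBinomialSum-bound d zero    N       = begin
  negBinomialSum (suc d) 0 N * 1   ≡⟨ *-identityʳ _ ⟩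
  negBinomialSum (suc d) 0 N       ≤⟨ negBinomialSum-0-≤ (suc d) N ⟩
  suc d ^ N                        ≡⟨ cong (suc d ^_) (sym (+-identityʳ N)) ⟩
  suc d ^ (N + 0)                  ∎
  where open ≤-Reasoning
negBinomialSum-bound d (suc m) zero    = z≤n
negBinomialSum-bound d (suc m) (suc N) = begin
  X * (d * d ^ m)                  ≡⟨ rearrange X d (d ^ m) ⟩
  d * X * d ^ m                    ≤⟨ *-monoˡ-≤ (d ^ m) (negBinomialSum-shift d m N) ⟩
  suc d * V * d ^ m                ≡⟨ *-assoc (suc d) V (d ^ m) ⟩
  suc d * (V * d ^ m)              ≤⟨ *-monoʳ-≤ (suc d) (negBinomialSum-bound d m (suc N)) ⟩
  suc d * suc d ^ (suc N + m)      ≡⟨ cong (suc d ^_) (sym (+-suc (suc N) m)) ⟩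
  suc d ^ (suc N + suc m)          ∎
  where
  open ≤-Reasoning
  X = negBinomialSum (suc d) (suc m) (suc N)
  V = negBinomialSum (suc d) m (suc N)
  rearrange : ∀ x d p → x * (d * p) ≡ d * x * p
  rearrange = solve-∀

[1+a*p]*q≤p*r⇒a*q<r : ∀ a p q r → .{{ℕ.NonZero p}} → 0 < r → suc (a * p) * q ≤ p * r → a * q < r
[1+a*p]*q≤p*r⇒a*q<r a p zero    r 0<r _ = subst (_< r) (sym (*-zeroʳ a)) 0<r
[1+a*p]*q≤p*r⇒a*q<r a p (suc q) r _   h = *-cancelˡ-< p (a * suc q) r (begin-strict
  p * (a * suc q)        ≡⟨ swap p a (suc q) ⟩
  a * p * suc q          <⟨ m<n+m (a * p * suc q) (s≤s z≤n) ⟩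
  suc q + a * p * suc q  ≤⟨ h ⟩
  p * r                  ∎)
  where
  open ≤-Reasoning
  swap : ∀ p a q → p * (a * q) ≡ a * p * q
  swap = solve-∀

*^<negBinomialSum⇒*^<^ : ∀ n d m N →
  n * suc d ^ N < negBinomialSum (suc d) m N → n * d ^ m < suc d ^ m
*^<negBinomialSum⇒*^<^ n d m N lt =
  [1+a*p]*q≤p*r⇒a*q<r n (suc d ^ N) (d ^ m) (suc d ^ m) {{m^n≢0 (suc d) N}} (m^n>0 (suc d) m) (begin
  suc (n * suc d ^ N) * d ^ m       ≤⟨ *-monoˡ-≤ (d ^ m) lt ⟩
  negBinomialSum (suc d) m N * d ^ m ≤⟨ negBinomialSum-bound d m N ⟩
  suc d ^ (N + m)                   ≡⟨ ^-distribˡ-+-* (suc d) N m ⟩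
  suc d ^ N * suc d ^ m             ∎)
  where open ≤-Reasoning

fromℕ : ℕ → ℚ
fromℕ n = + n / 1

fromℕ≡mkℚ : ∀ n → fromℕ n ≡ mkℚ (+ n) 0 (Coprime.sym (Coprime.1-coprimeTo n))
fromℕ≡mkℚ n = ℚₚ.normalize-coprime (Coprime.sym (Coprime.1-coprimeTo n))

fromℕ-* : ∀ a b → fromℕ (a * b) ≡ fromℕ a ℚ.* fromℕ b
fromℕ-* a b = begin
  + (a * b) / 1            ≡⟨ cong (_/ 1) (ℤₚ.pos-* a b) ⟩
  (+ a ℤ.* + b) / 1        ≡⟨ cong₂ ℚ._*_ (fromℕ≡mkℚ a) (fromℕ≡mkℚ b) ⟨
  fromℕ a ℚ.* fromℕ b      ∎
  where open ≡-Reasoning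

fromℕ-+ : ∀ a b → fromℕ (a + b) ≡ fromℕ a ℚ.+ fromℕ b
fromℕ-+ a b = begin
  + (a + b) / 1                        ≡⟨ cong (_/ 1) (ℤₚ.pos-+ a b) ⟩
  (+ a ℤ.+ + b) / 1                    ≡⟨ cong₂ (λ x y → (x ℤ.+ y) / 1) (*1 a) (*1 b) ⟨
  (+ a ℤ.* + 1 ℤ.+ + b ℤ.* + 1) / 1    ≡⟨ cong₂ ℚ._+_ (fromℕ≡mkℚ a) (fromℕ≡mkℚ b) ⟨
  fromℕ a ℚ.+ fromℕ b                  ∎
  where
  open ≡-Reasoning
  *1 : ∀ n → + n ℤ.* + 1 ≡ + n
  *1 n = ℤₚ.*-identityʳ (+ n)

fromℕ-mono-≤ : ∀ {a b} → a ≤ b → fromℕ a ℚ.≤ fromℕ b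
fromℕ-mono-≤ {a} {b} a≤b rewrite fromℕ≡mkℚ a | fromℕ≡mkℚ b =
  ℚ.*≤* (subst₂ ℤ._≤_ (sym (ℤₚ.*-identityʳ (+ a))) (sym (ℤₚ.*-identityʳ (+ b))) (ℤ.+≤+ a≤b))

fromℕ-cancel-< : ∀ {a b} → fromℕ a ℚ.< fromℕ b → a < b
fromℕ-cancel-< {a} {b} p rewrite fromℕ≡mkℚ a | fromℕ≡mkℚ b with p
... | ℚ.*<* q = ℤₚ.drop‿+<+ (subst₂ ℤ._<_ (ℤₚ.*-identityʳ (+ a)) (ℤₚ.*-identityʳ (+ b)) q)

/-*-fromℕ : ∀ m d → (+ m / suc d) ℚ.* fromℕ (suc d) ≡ fromℕ m
/-*-fromℕ m d = ℚₚ.toℚᵘ-injective (begin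
  toℚᵘ ((+ m / suc d) ℚ.* fromℕ (suc d))          ≈⟨ ℚₚ.toℚᵘ-homo-* (+ m / suc d) (fromℕ (suc d)) ⟩
  toℚᵘ (+ m / suc d) ℚᵘ.* toℚᵘ (fromℕ (suc d))    ≈⟨ ℚᵘₚ.*-cong (toℚᵘ-/ (+ m) d) (toℚᵘ-/ (+ suc d) 0) ⟩
  mkℚᵘ (+ m) d ℚᵘ.* mkℚᵘ (+ suc d) 0              ≈⟨ *≡* cross-multiply ⟩
  mkℚᵘ (+ m) 0                                    ≈⟨ toℚᵘ-/ (+ m) 0 ⟨
  toℚᵘ (fromℕ m)                                  ∎)
  where
  open ℚᵘₚ.≃-Reasoning
  toℚᵘ-/ : ∀ i n → toℚᵘ (i / suc n) ℚᵘ.≃ mkℚᵘ i n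
  toℚᵘ-/ i n = ℚₚ.toℚᵘ-fromℚᵘ (mkℚᵘ i n)
  cross-multiply : (+ m ℤ.* + suc d) ℤ.* + 1 ≡ + m ℤ.* + suc (d * 1)
  cross-multiply = trans (ℤₚ.*-identityʳ _) (cong (λ k → + m ℤ.* + suc k) (sym (*-identityʳ d)))

fromℕ-nonNeg : ∀ n → ℚ.NonNegative (fromℕ n)
fromℕ-nonNeg n = ℚₚ.normalize-nonNeg n 1

/-nonNeg : ∀ m d → ℚ.NonNegative (+ m / suc d)
/-nonNeg m d = ℚₚ.normalize-nonNeg m (suc d)

expTerm-nonNeg : ∀ x → ℚ.NonNegative x → ∀ i → ℚ.NonNegative (expTerm x i)
expTerm-nonNeg x x≥0 zero    = _
expTerm-nonNeg x x≥0 (suc i) = ℚₚ.nonNeg*nonNeg⇒nonNeg (expTerm x i ℚ.* x) (+ 1 / suc i)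
  where
  instance
    _ = x≥0
    _ = expTerm-nonNeg x x≥0 i
    _ = ℚₚ.nonNeg*nonNeg⇒nonNeg (expTerm x i) x
    _ = /-nonNeg 1 i

expTerm-bound : ∀ m d i → expTerm (+ m / suc d) i ℚ.* fromℕ (suc d ^ i) ℚ.≤ fromℕ (multichoose m i)
expTerm-bound m d zero    = ℚₚ.≤-refl
expTerm-bound m d (suc i) = begin
  t ℚ.* q ℚ.* r ℚ.* fromℕ (suc d * suc d ^ i)   ≡⟨ cong (t ℚ.* q ℚ.* r ℚ.*_) (fromℕ-* (suc d) (suc d ^ i)) ⟩
  t ℚ.* q ℚ.* r ℚ.* (c ℚ.* P)                   ≡⟨ solve 5 (λ t q r c p → t :* q :* r :* (c :* p) := q :* c :* (t :* p) :* r)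
                                                          refl t q r c P ⟩
  q ℚ.* c ℚ.* (t ℚ.* P) ℚ.* r                   ≡⟨ cong (λ x → x ℚ.* (t ℚ.* P) ℚ.* r) (/-*-fromℕ m d) ⟩
  fromℕ m ℚ.* (t ℚ.* P) ℚ.* r                   ≤⟨ ℚₚ.*-monoʳ-≤-nonNeg r (ℚₚ.*-monoˡ-≤-nonNeg (fromℕ m) IH) ⟩
  fromℕ m ℚ.* fromℕ (multichoose m i) ℚ.* r     ≡⟨ cong (ℚ._* r) (fromℕ-* m (multichoose m i)) ⟨
  fromℕ (m * multichoose m i) ℚ.* r             ≤⟨ ℚₚ.*-monoʳ-≤-nonNeg r (fromℕ-mono-≤ (multichoose-ratio m i)) ⟩
  fromℕ (suc i * M) ℚ.* r                       ≡⟨ cong (ℚ._* r) (fromℕ-* (suc i) M) ⟩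
  fromℕ (suc i) ℚ.* fromℕ M ℚ.* r               ≡⟨ solve 3 (λ a b r → a :* b :* r := b :* (r :* a))
                                                          refl (fromℕ (suc i)) (fromℕ M) r ⟩
  fromℕ M ℚ.* (r ℚ.* fromℕ (suc i))             ≡⟨ cong (fromℕ M ℚ.*_) (/-*-fromℕ 1 i) ⟩
  fromℕ M ℚ.* ℚ.1ℚ                              ≡⟨ ℚₚ.*-identityʳ (fromℕ M) ⟩
  fromℕ M                                       ∎
  where
  open ℚₚ.≤-Reasoning
  open +-*-Solver
  q = + m / suc d
  t = expTerm q i
  r = + 1 / suc i
  c = fromℕ (suc d)
  P = fromℕ (suc d ^ i)
  M = multichoose m (suc i)
  IH = expTerm-bound m d i
  instance
    _ = fromℕ-nonNeg m
    _ = /-nonNeg 1 i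
    _ = expTerm-nonNeg q (/-nonNeg m d) i

expPartial-bound : ∀ m d N →
  expPartial (+ m / suc d) N ℚ.* fromℕ (suc d ^ N) ℚ.≤ fromℕ (negBinomialSum (suc d) m N)
expPartial-bound m d zero    = ℚₚ.≤-refl
expPartial-bound m d (suc N) = begin
  (S ℚ.+ t) ℚ.* fromℕ (suc d * suc d ^ N)     ≡⟨ cong ((S ℚ.+ t) ℚ.*_) (fromℕ-* (suc d) (suc d ^ N)) ⟩
  (S ℚ.+ t) ℚ.* (c ℚ.* P)                     ≡⟨ solve 4 (λ s t c p → (s :+ t) :* (c :* p) := c :* (s :* p :+ t :* p))
                                                        refl S t c P ⟩
  c ℚ.* (S ℚ.* P ℚ.+ t ℚ.* P)                 ≤⟨ ℚₚ.*-monoˡ-≤-nonNeg c (ℚₚ.+-mono-≤ IH (expTerm-bound m d N)) ⟩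
  c ℚ.* (fromℕ V ℚ.+ fromℕ M)                 ≡⟨ cong (c ℚ.*_) (fromℕ-+ V M) ⟨
  c ℚ.* fromℕ (V + M)                         ≡⟨ fromℕ-* (suc d) (V + M) ⟨
  fromℕ (suc d * (V + M))                     ∎
  where
  open ℚₚ.≤-Reasoning
  open +-*-Solver
  S = expPartial (+ m / suc d) N
  t = expTerm (+ m / suc d) N
  c = fromℕ (suc d)
  P = fromℕ (suc d ^ N)
  V = negBinomialSum (suc d) m N
  M = multichoose m N
  IH = expPartial-bound m d N
  instance _ = fromℕ-nonNeg (suc d)

<expPartial⇒*^<^ : ∀ n d m N → fromℕ n ℚ.< expPartial (+ m / suc d) N → n * d ^ m < suc d ^ m
<expPartial⇒*^<^ n d m N n<S = *^<negBinomialSum⇒*^<^ n d m N (fromℕ-cancel-< (begin-strict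
  fromℕ (n * P)                              ≡⟨ fromℕ-* n P ⟩
  fromℕ n ℚ.* fromℕ P                        <⟨ ℚₚ.*-monoˡ-<-pos (fromℕ P) {{P>0}} n<S ⟩
  expPartial (+ m / suc d) N ℚ.* fromℕ P     ≤⟨ expPartial-bound m d N ⟩
  fromℕ (negBinomialSum (suc d) m N)         ∎))
  where
  open ℚₚ.≤-Reasoning
  P = suc d ^ N
  P>0 : ℚ.Positive (fromℕ P)
  P>0 = ℚₚ.normalize-pos P 1 {{_}} {{m^n≢0 (suc d) N}}

-- Choosing classes by conditional expectations

∑-const : ∀ n a → ∑[ i < n ] a ≡ n * a
∑-const zero    a = refl
∑-const (suc n) a = cong (_+_ a) (∑-const n a)

≤-∑ : ∀ {n} (t : Fin n → ℕ) i → t i ≤ sum t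
≤-∑ t zero    = m≤m+n (t zero) _
≤-∑ t (suc i) = ≤-trans (≤-∑ (λ j → t (suc j)) i) (m≤n+m _ (t zero))

∑<*⇒∃< : ∀ {c} (g : Fin c → ℕ) B → sum g < c * B → ∃ λ j → g j < B
∑<*⇒∃< {zero}  g B ()
∑<*⇒∃< {suc c} g B lt with g zero <? B
... | yes g₀<B = zero , g₀<B
... | no  g₀≮B = let j , gj<B = ∑<*⇒∃< (λ j → g (suc j)) B rest in suc j , gj<B
  where
  rest : ∑[ j < c ] g (suc j) < c * B
  rest = +-cancelˡ-< B _ _ (≤-<-trans (+-monoˡ-≤ _ (≮⇒≥ g₀≮B)) lt)

_≢?_ : (y x : ℕ) → Dec (y ≢ x)
y ≢? x = ¬? (y ≟ x)

remove : ℕ → List ℕ → List ℕ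
remove x = filter (_≢? x)

∈-remove⁻ : ∀ x l {y} → y ∈ remove x l → y ∈ l × y ≢ x
∈-remove⁻ x l = ∈-filter⁻ (_≢? x)

length-remove : ∀ {x l} → Unique l → x ∈ l → length l ≡ suc (length (remove x l))
length-remove {x} {y ∷ l} (y∉l ∷ _) (here refl) = begin
  suc (length l)                    ≡⟨ cong (suc ∘ length) (filter-all (_≢? x) (All.map (_∘ sym) y∉l)) ⟨
  suc (length (remove x l))         ≡⟨ cong (suc ∘ length) (filter-reject (_≢? x) (λ x≢x → x≢x refl)) ⟨
  suc (length (remove x (x ∷ l)))   ∎
  where open ≡-Reasoning
length-remove {x} {y ∷ l} (y∉l ∷ u) (there x∈l) = begin
  suc (length l)                    ≡⟨ cong suc (length-remove u x∈l) ⟩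
  suc (suc (length (remove x l)))   ≡⟨ cong (suc ∘ length) (filter-accept (_≢? x) (All.lookup y∉l x∈l)) ⟨
  suc (length (remove x (y ∷ l)))   ∎
  where open ≡-Reasoning

-- The state of a vertex while classes are fixed one colour at a time: nothing once one of its
-- candidate colours got its target class, otherwise just (l , e) with l its candidates not yet
-- treated and e the number of treated ones (which all got a wrong class).
State : Set
State = Maybe (List ℕ × ℕ)

Hits : ∀ {c} → (ℕ → Fin c) → Fin c → State → Set
Hits σ k nothing        = ⊤
Hits σ k (just (l , e)) = Any (λ y → σ y ≡ k) l

update : ∀ {c} → ℕ → Fin c → (ℕ → Fin c) → ℕ → Fin c
update x j σ y with y ≟ x
... | yes _ = j
... | no  _ = σ y

update-≡ : ∀ {c} x (j : Fin c) σ → update x j σ x ≡ j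
update-≡ x j σ with x ≟ x
... | yes _   = refl
... | no  x≢x = ⊥-elim (x≢x refl)

update-≢ : ∀ {c} {x y} (j : Fin c) σ → y ≢ x → update x j σ y ≡ σ y
update-≢ {x = x} {y} j σ y≢x with y ≟ x
... | yes y≡x = ⊥-elim (y≢x y≡x)
... | no  _   = refl

module _ (d : ℕ) where

  -- (d + 1)^(length l + e) times the probability that a uniformly random choice of classes for
  -- the untreated candidates still misses the target class.
  weight : State → ℕ
  weight nothing        = 0
  weight (just (l , e)) = d ^ length l * suc d ^ e

  totalWeight : ∀ {n} → (Fin n → State) → ℕ
  totalWeight {n} s = ∑[ v < n ] weight (s v)

  -- assign x j k: colour x receives class j, at a vertex with target class k.
  assign : ℕ → Fin (suc d) → Fin (suc d) → State → State
  assign x j k nothing = nothing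
  assign x j k (just (l , e)) with x ∈? l | k Fin.≟ j
  ... | no  _ | _     = just (l , e)
  ... | yes _ | yes _ = nothing
  ... | yes _ | no  _ = just (remove x l , suc e)

  Admissible : List ℕ → ℕ → State → Set
  Admissible X B nothing        = ⊤
  Admissible X B (just (l , e)) = Unique l × l ⊆ X × B ≤ suc d ^ (length l + e)

  assign-∉ : ∀ {x l} e j k → x ∉ l → assign x j k (just (l , e)) ≡ just (l , e)
  assign-∉ {x} {l} e j k x∉l with x ∈? l
  ... | yes x∈l = ⊥-elim (x∉l x∈l)
  ... | no  _   = refl

  assign-hit : ∀ {x l} e k → x ∈ l → assign x k k (just (l , e)) ≡ nothing
  assign-hit {x} {l} e k x∈l with x ∈? l | k Fin.≟ k
  ... | no  x∉l | _       = ⊥-elim (x∉l x∈l)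
  ... | yes _   | yes _   = refl
  ... | yes _   | no  k≢k = ⊥-elim (k≢k refl)

  assign-miss : ∀ {x l} e {j k} → x ∈ l → k ≢ j → assign x j k (just (l , e)) ≡ just (remove x l , suc e)
  assign-miss {x} {l} e {j} {k} x∈l k≢j with x ∈? l | k Fin.≟ j
  ... | no  x∉l | _       = ⊥-elim (x∉l x∈l)
  ... | yes _   | yes k≡j = ⊥-elim (k≢j k≡j)
  ... | yes _   | no  _   = refl

  ∑-weight-assign : ∀ {X B} x k s → Admissible X B s →
                    ∑[ j < suc d ] weight (assign x j k s) ≡ suc d * weight s
  ∑-weight-assign x k nothing        _       = ∑-const (suc d) 0
  ∑-weight-assign x k (just (l , e)) (u , _) = by-membership (x ∈? l)
    where
    open ≡-Reasoning
    s  = just (l , e)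
    s′ = just (remove x l , suc e)
    regroup : ∀ d a b → d * (a * (suc d * b)) ≡ suc d * (d * a * b)
    regroup = solve-∀
    by-membership : Dec (x ∈ l) → ∑[ j < suc d ] weight (assign x j k s) ≡ suc d * weight s
    by-membership (no x∉l)  =
      trans (sum-cong-≗ (λ j → cong weight (assign-∉ e j k x∉l))) (∑-const (suc d) (weight s))
    by-membership (yes x∈l) = begin
      ∑[ j < suc d ] weight (assign x j k s)
        ≡⟨ sum-remove {i = k} (λ j → weight (assign x j k s)) ⟩
      weight (assign x k k s) + ∑[ j < d ] weight (assign x (punchIn k j) k s)
        ≡⟨ cong₂ _+_ (cong weight (assign-hit e k x∈l))
                     (sum-cong-≗ (λ j → cong weight (assign-miss e x∈l (punchInᵢ≢i k j ∘ sym)))) ⟩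
      ∑[ j < d ] weight s′                                   ≡⟨ ∑-const d (weight s′) ⟩
      d * (d ^ length (remove x l) * suc d ^ suc e)          ≡⟨ regroup d (d ^ length (remove x l)) (suc d ^ e) ⟩
      suc d * (d ^ suc (length (remove x l)) * suc d ^ e)
        ≡⟨ cong (λ a → suc d * (d ^ a * suc d ^ e)) (length-remove u x∈l) ⟨
      suc d * weight s                                       ∎

  ∑-totalWeight-assign : ∀ {n X B} x (k : Fin n → Fin (suc d)) s → (∀ v → Admissible X B (s v)) →
    ∑[ j < suc d ] totalWeight (λ v → assign x j (k v) (s v)) ≡ suc d * totalWeight s
  ∑-totalWeight-assign {n} x k s adm = begin
    ∑[ j < suc d ] ∑[ v < n ] weight (assign x j (k v) (s v))
      ≡⟨ ∑-comm (λ j v → weight (assign x j (k v) (s v))) ⟩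
    ∑[ v < n ] ∑[ j < suc d ] weight (assign x j (k v) (s v))
      ≡⟨ sum-cong-≗ (λ v → ∑-weight-assign x (k v) (s v) (adm v)) ⟩
    ∑[ v < n ] (suc d * weight (s v))
      ≡⟨ *-distribˡ-sum (suc d) (λ v → weight (s v)) ⟨
    suc d * totalWeight s                                        ∎
    where open ≡-Reasoning

  assign-admissible : ∀ {x X B} j k s → Admissible (x ∷ X) B s → Admissible X B (assign x j k s)
  assign-admissible j k nothing _ = tt
  assign-admissible {x} {X} {B} j k (just (l , e)) (u , l⊆x∷X , B≤) with x ∈? l | k Fin.≟ j
  ... | no  x∉l | _     = u , l⊆X , B≤
    where
    l⊆X : l ⊆ X
    l⊆X y∈l with l⊆x∷X y∈l
    ... | here refl = ⊥-elim (x∉l y∈l)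
    ... | there y∈X = y∈X
  ... | yes _   | yes _ = tt
  ... | yes x∈l | no  _ = Unique.filter⁺ (_≢? x) u , l∖x⊆X , B≤′
    where
    l∖x⊆X : remove x l ⊆ X
    l∖x⊆X y∈l∖x with ∈-remove⁻ x l y∈l∖x
    ... | y∈l , y≢x with l⊆x∷X y∈l
    ...   | here y≡x  = ⊥-elim (y≢x y≡x)
    ...   | there y∈X = y∈X
    B≤′ : B ≤ suc d ^ (length (remove x l) + suc e)
    B≤′ = ≤-trans B≤ (≤-reflexive (cong (suc d ^_)
            (trans (cong (_+ e) (length-remove u x∈l)) (sym (+-suc (length (remove x l)) e)))))

  hits-assign : ∀ {x j k σ} s → Hits σ k (assign x j k s) → Hits (update x j σ) k s
  hits-assign nothing _ = tt
  hits-assign {x} {j} {k} {σ} (just (l , e)) hits with x ∈? l | k Fin.≟ j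
  ... | no  x∉l | _     = let y , y∈l , σy≡k = find hits in
    lose y∈l (trans (update-≢ j σ (λ y≡x → x∉l (subst (_∈ l) y≡x y∈l))) σy≡k)
  ... | yes x∈l | yes k≡j = lose x∈l (trans (update-≡ x j σ) (sym k≡j))
  ... | yes _   | no  _   = let y , y∈l∖x , σy≡k = find hits
                                y∈l , y≢x = ∈-remove⁻ x l y∈l∖x in
    lose y∈l (trans (update-≢ j σ y≢x) σy≡k)

  hits-exhausted : ∀ {B} {σ : ℕ → Fin (suc d)} {k} s → Admissible [] B s → weight s < B → Hits σ k s
  hits-exhausted nothing              _                      _ = tt
  hits-exhausted (just ([] , e))      (_ , _ , B≤)           w<B =
    ⊥-elim (<⇒≱ w<B (≤-trans B≤ (≤-reflexive (sym (*-identityˡ (suc d ^ e))))))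
  hits-exhausted (just (y ∷ l , e))   (_ , y∷l⊆[] , _)       _ with y∷l⊆[] (here refl)
  ... | ()

  hitting-assignment : ∀ {n} X B (k : Fin n → Fin (suc d)) s →
    (∀ v → Admissible X B (s v)) → totalWeight s < B →
    Σ (ℕ → Fin (suc d)) λ σ → ∀ v → Hits σ (k v) (s v)
  hitting-assignment []      B k s adm w<B =
    (λ _ → zero) , λ v → hits-exhausted (s v) (adm v) (≤-<-trans (≤-∑ (λ v → weight (s v)) v) w<B)
  hitting-assignment {n} (x ∷ X) B k s adm w<B =
    update x j σ , λ v → hits-assign (s v) (hits v)
    where
    after : Fin (suc d) → Fin n → State
    after j v = assign x j (k v) (s v)
    averaged : ∑[ j < suc d ] totalWeight (after j) < suc d * B
    averaged = subst (_< suc d * B) (sym (∑-totalWeight-assign x k s adm)) (*-monoʳ-< (suc d) w<B)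
    chosen = ∑<*⇒∃< (λ j → totalWeight (after j)) B averaged
    j = proj₁ chosen
    next = hitting-assignment X B k (after j) (λ v → assign-admissible j (k v) (s v) (adm v)) (proj₂ chosen)
    σ = proj₁ next
    hits = proj₂ next

-- Conflict-free list colourings

class-assignment : ∀ {n m} d (k : Fin n → Fin (suc d)) (f : Fin n → Fin m → ℕ) →
  (∀ v → Injective _≡_ _≡_ (f v)) → n * d ^ m < suc d ^ m →
  Σ (ℕ → Fin (suc d)) λ σ → ∀ v → ∃ λ i → σ (f v i) ≡ k v
class-assignment {n} {m} d k f f-injective n*d^m<c^m = σ , λ v → Any.tabulate⁻ (hits v)
  where
  palette : List ℕ
  palette = concat (tabulate (λ v → tabulate (f v)))
  start : Fin n → State
  start v = just (tabulate (f v) , 0)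
  admissible : ∀ v → Admissible d palette (suc d ^ m) (start v)
  admissible v = Unique.tabulate⁺ (f-injective v)
               , (λ y∈fv → ∈-concat⁺′ y∈fv (∈-tabulate⁺ v))
               , ≤-reflexive (cong (suc d ^_) (sym (trans (+-identityʳ _) (length-tabulate (f v)))))
  start-weight : totalWeight d start ≡ n * d ^ m
  start-weight = trans (sum-cong-≗ λ v → trans (cong (λ a → d ^ a * 1) (length-tabulate (f v))) (*-identityʳ _))
                       (∑-const n (d ^ m))
  found = hitting-assignment d palette (suc d ^ m) k start admissible
            (subst (_< suc d ^ m) (sym start-weight) n*d^m<c^m)
  σ = proj₁ found
  hits = proj₂ found

CFColorableWith⇒CFChoosable : ∀ {n} d m (H : Hypergraph n) →
  CFColorableWith H (suc d) → n * d ^ m < suc d ^ m → CFChoosable H m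
CFColorableWith⇒CFChoosable {n} d m H (C₀ , C₀-range , C₀-cf) n*d^m<c^m L _ L-large = C , C∈L , C-cf
  where
  class : Fin n → Fin (suc d)
  class v = fromℕ< {m = C₀ v ∸ 1} (s≤s (∸-monoˡ-≤ 1 (proj₂ (C₀-range v))))
  class-injective : ∀ {u v} → class u ≡ class v → C₀ u ≡ C₀ v
  class-injective {u} {v} eq = ∸-cancelʳ-≡ (proj₁ (C₀-range u)) (proj₁ (C₀-range v))
    (trans (sym (toℕ-fromℕ< _)) (trans (cong toℕ eq) (toℕ-fromℕ< _)))
  f : Fin n → Fin m → ℕ
  f v = proj₁ (L-large v)
  assignment = class-assignment d class f (λ v → proj₁ (proj₂ (L-large v))) n*d^m<c^m
  σ = proj₁ assignment
  pick : Fin n → Fin m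
  pick v = proj₁ (proj₂ assignment v)
  σ-pick : ∀ v → σ (f v (pick v)) ≡ class v
  σ-pick v = proj₂ (proj₂ assignment v)
  C : Coloring n
  C v = f v (pick v)
  C∈L : ∀ v → L v (C v)
  C∈L v = proj₂ (proj₂ (L-large v)) (pick v)
  C-cf : ConflictFree H C
  C-cf E E∈H = let v , v∈E , unique = C₀-cf E E∈H in
    v , v∈E , λ u u∈E Cu≡Cv →
      unique u u∈E (class-injective (trans (sym (σ-pick u)) (trans (cong σ Cu≡Cv) (σ-pick v))))

¬CFColorableWith-0 : ∀ {n} (H : Hypergraph (suc n)) → ¬ CFColorableWith H 0
¬CFColorableWith-0 H (_ , range , _) = 1+n≰n (≤-trans (proj₁ (range zero)) (proj₂ (range zero)))

¬CFChoosable-0 : ∀ {n} (H : Hypergraph (suc n)) → ¬ CFChoosable H 0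
¬CFChoosable-0 H choosable =
  proj₁ (proj₂ (choosable (λ _ _ → ⊥) (λ _ _ ()) (λ _ → (λ ()) , (λ { {()} }) , (λ ())))) zero

mainTheorem15 : (n : ℕ) → 1 ≤ n → (H : Hypergraph n) → (c k : ℕ) →
    IsChiCF H c → IsChCF H k → BoundHolds k c n
mainTheorem15 (suc n) _ H zero    _       (colorable , _) _               = ⊥-elim (¬CFColorableWith-0 H colorable)
mainTheorem15 (suc n) _ H (suc d) zero    _               (choosable , _) = ⊥-elim (¬CFChoosable-0 H choosable)
mainTheorem15 (suc n) _ H (suc d) (suc m) (colorable , _) (_ , minimal) N
  with expPartial (+ m / suc d) N ℚ.≤? fromℕ (suc n)
... | yes S≤n = S≤n
... | no  S≰n = ⊥-elim (1+n≰n (minimal m (CFColorableWith⇒CFChoosable d m H colorable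
                  (<expPartial⇒*^<^ (suc n) d m N (ℚₚ.≰⇒> S≰n)))))
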